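{- For integers $a,b\ge0$ let $\rho_{a\times b}$ be the $a\times b$ rectangle poset. Then \[\sum_{a\ge0}\sum_{b\ge0}|\mathbf{E}(J(\rho_{a\times b}))|\,x^b y^a=\frac{(1+x)(1+y)}{1-(1+x)y^2-(1+y)x^2}.\]
   Context: $\rho_{a\times b}$ is the rectangular Young diagram with $a$ rows of size $b$, viewed as a poset on its boxes, where a box is $\le$ another iff it lies weakly northwest of it (equivalently, the product of an $a$-element chain and a $b$-element chain). $J(Q)$ is the lattice of order ideals of $Q$ ordered by containment. For a finite lattice $L$ and $x\in L$, an Ungar move sends $x$ to $\bigwedge(\{x\}\cup T)$ with $T$ a subset of the elements covered by $x$; it is nontrivial if $T\neq\emptyset$. An element $x$ is an Eeta win in $L$ if, in the game on the interval $[\hat0,x]$ where starting at $x$ two players (Atniss first, then Eeta) alternately make nontrivial Ungar moves and the player unable to move loses, Atniss has no winning strategy; recursively, $\hat0$ is an Eeta win and $x$ is an Eeta win iff every element obtainable from $x$ by a nontrivial Ungar move is not an Eeta win. $\mathbf{E}(L)$ is the set of Eeta wins in $L$. -}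

module Defs where

open import Data.Nat as ℕ using (ℕ; zero; suc; _∸_)
open import Data.Integer as ℤ using (ℤ; +_)
open import Data.Bool using (Bool; true; false; _∧_)
open import Data.Fin using (Fin; _≤_)
open import Data.Vec using (Vec; lookup; zipWith)
open import Data.List using (List; []; foldr; length)
open import Data.List.Relation.Unary.All using (All)
open import Data.List.Relation.Unary.Unique.Propositional using (Unique)
open import Data.List.Membership.Propositional using (_∈_)
open import Data.Product using (Σ; ∃; _×_)
open import Relation.Binary.PropositionalEquality using (_≡_; _≢_)
open import Data.Empty using (⊥)

-- Subsets of the boxes of the rectangle ρ_{a×b} = (a-chain) × (b-chain).
-- Box (i , j) : row i ∈ Fin a, column j ∈ Fin b.
-- A subset is an a × b Boolean array.

Sub : ℕ → ℕ → Set
Sub a b = Vec (Vec Bool b) a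

_∋_,_ : ∀ {a b} → Sub a b → Fin a → Fin b → Set
S ∋ i , j = lookup (lookup S i) j ≡ true

_⊆_ : ∀ {a b} → Sub a b → Sub a b → Set
S ⊆ T = ∀ i j → S ∋ i , j → T ∋ i , j

_⊂_ : ∀ {a b} → Sub a b → Sub a b → Set
S ⊂ T = S ⊆ T × S ≢ T

IsIdeal : ∀ {a b} → Sub a b → Set
IsIdeal S = ∀ i j i' j' → i' ≤ i → j' ≤ j → S ∋ i , j → S ∋ i' , j'

-- The lattice J(ρ_{a×b}): elements are ideals, order is containment,
-- and the meet is intersection.

_∩_ : ∀ {a b} → Sub a b → Sub a b → Sub a b
S ∩ T = zipWith (zipWith _∧_) S T

_⋖_ : ∀ {a b} → Sub a b → Sub a b → Set
t ⋖ x = IsIdeal t × t ⊂ x × (∀ z → IsIdeal z → t ⊂ z → z ⊂ x → ⊥)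

meet : ∀ {a b} → Sub a b → List (Sub a b) → Sub a b
meet x T = foldr _∩_ x T

UngarMove : ∀ {a b} → Sub a b → Sub a b → Set
UngarMove {a} {b} x y =
  Σ (List (Sub a b)) λ T → T ≢ [] × All (λ t → t ⋖ x) T × y ≡ meet x T

-- Eeta wins / Atniss wins (inductive, i.e. the recursive definition on the
-- finite, well-founded game): x is an Eeta win iff every nontrivial Ungar
-- move from x leads to a non-Eeta-win, i.e. to a position from which the
-- next player can move to an Eeta win.
mutual
  data EetaWin {a b : ℕ} (x : Sub a b) : Set where
    eeta : (∀ y → UngarMove x y → AtnissWin y) → EetaWin x

  data AtnissWin {a b : ℕ} (x : Sub a b) : Set where
    atniss : ∀ y → UngarMove x y → EetaWin y → AtnissWin x

CardE : (a b : ℕ) → ℕ → Set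
CardE a b n = Σ (List (Sub a b)) λ es →
  Unique es
  × (∀ x → x ∈ es → IsIdeal x × EetaWin x)
  × (∀ x → IsIdeal x → EetaWin x → x ∈ es)
  × length es ≡ n

-- Formal power series in x, y over ℤ: f i j = coefficient of x^i y^j.

PS : Set
PS = ℕ → ℕ → ℤ

sumTo : ℕ → (ℕ → ℤ) → ℤ
sumTo zero h = h zero
sumTo (suc n) h = sumTo n h ℤ.+ h (suc n)

infixl 6 _⊕_ _⊖_
infixl 7 _⊛_

_⊕_ : PS → PS → PS
(f ⊕ g) i j = f i j ℤ.+ g i j

_⊖_ : PS → PS → PS
(f ⊖ g) i j = f i j ℤ.- g i j

_⊛_ : PS → PS → PS
(f ⊛ g) i j = sumTo i λ k → sumTo j λ l → f k l ℤ.* g (i ∸ k) (j ∸ l)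

𝟙 : PS
𝟙 zero zero = + 1
𝟙 _ _ = + 0

X : PS
X 1 zero = + 1
X _ _ = + 0

Y : PS
Y zero 1 = + 1
Y _ _ = + 0

{-# OPTIONS --safe #-}
module Submission where

open import Defs
open import Data.Nat using (ℕ)
open import Data.Integer using (+_)
open import Data.Product using (Σ; _×_; _,_)
open import Relation.Binary.PropositionalEquality using (_≡_)

-- An order ideal of the a × b rectangle is a lattice path from its north-east to its south-west
-- corner, and the ideals it covers are obtained by flipping one corner SW of the path into WS.
-- A nontrivial Ungar move therefore flips a nonempty set of corners simultaneously.  The Eeta
-- wins are exactly the paths accepted by a five-state automaton: every move from an accepted
-- path leads to a rejected one, and every rejected path has a move to an accepted one; both
-- facts reduce to finite checks on the reachable states of two auxiliary automata.  Counting
-- accepted paths by their first step gives a linear recurrence, which is the coefficientwise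
-- form of the generating-function identity.

module EetaWins where

  open import Data.Nat as ℕ using (ℕ; zero; suc; pred; _+_; _∸_; _≤_; _<_; _⊓_; _<ᵇ_; z≤n; s≤s)
  open import Data.Nat.Tactic.RingSolver using (solve-∀)
  open import Data.Nat.Properties as ℕₚ using (≤-refl; ≤-trans; ≤-antisym; <-irrefl)
  open import Data.Bool using (Bool; true; false; T; T?; not; _∧_; _∨_; if_then_else_)
  import Data.Bool.Properties as Boolₚ
  open import Data.Fin as Fin using (Fin; zero; suc; toℕ; fromℕ<)
  import Data.Fin.Properties as Finₚ
  open import Data.Vec using (Vec; []; _∷_; lookup; tabulate; replicate; zipWith)
  import Data.Vec.Properties as Vecₚ
  open import Data.List using (List; []; _∷_; map; _++_; length; concatMap; deduplicate)
  import Data.List.Properties as Listₚ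
  open import Data.List.Membership.Propositional.Properties
    using (∈-map⁺; ∈-map⁻; ∈-++⁺ˡ; ∈-++⁺ʳ; ∈-++⁻)
  open import Data.List.Relation.Unary.Unique.Propositional using (Unique; []; _∷_)
  import Data.List.Relation.Unary.Unique.Propositional.Properties as Uniqueₚ
  open import Data.List.Membership.Propositional using (_∈_)
  import Data.List.Membership.DecPropositional as Membership
  open import Data.Bool.ListAction using (any)
  open import Data.List.Relation.Unary.All as All using (All; []; _∷_)
  import Data.List.Relation.Unary.All.Properties as Allₚ
  import Data.Product.Properties as ×ₚ
  open import Data.List.Relation.Unary.Any using (here; there)
  open import Data.Product using (Σ; _×_; _,_; proj₁; proj₂)
  open import Data.Sum using (_⊎_; inj₁; inj₂)
  open import Data.Empty using (⊥; ⊥-elim)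
  open import Function using (_∘_; _⇔_; Equivalence; mk⇔)
  open import Data.Nat.Induction using (<-wellFounded)
  open import Induction.WellFounded using (Acc; acc)
  open import Relation.Nullary using (¬_; Dec; yes; no; does; contradiction)
  open import Relation.Nullary.Decidable using (dec-true; dec-false; from-yes; map′; _×-dec_)
  open import Relation.Binary.Definitions using (DecidableEquality)
  open import Relation.Binary.PropositionalEquality
    using (_≡_; _≢_; refl; sym; trans; cong; cong₂; subst; subst₂; _≗_; module ≡-Reasoning)

  private variable
    a b : ℕ

  -- Young diagrams

  Antitone : (Fin a → ℕ) → Set
  Antitone f = ∀ {i i'} → i' Fin.≤ i → f i ≤ f i'

  BoundedBy : ℕ → (Fin a → ℕ) → Set
  BoundedBy b f = ∀ i → f i ≤ b

  diagram : (Fin a → ℕ) → Sub a b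
  diagram f = tabulate λ i → tabulate λ j → toℕ j <ᵇ f i

  module _ (f : Fin a → ℕ) {i : Fin a} {j : Fin b} where

    diagram-entry : lookup (lookup (diagram f) i) j ≡ (toℕ j <ᵇ f i)
    diagram-entry = trans (cong (λ row → lookup row j) (Vecₚ.lookup∘tabulate _ i))
                          (Vecₚ.lookup∘tabulate _ j)

    ∋-diagram⁻ : diagram f ∋ i , j → toℕ j < f i
    ∋-diagram⁻ h = ℕₚ.<ᵇ⇒< _ _ (Equivalence.from Boolₚ.T-≡ (trans (sym diagram-entry) h))

    ∋-diagram⁺ : toℕ j < f i → diagram f ∋ i , j
    ∋-diagram⁺ j<fi = trans diagram-entry (Equivalence.to Boolₚ.T-≡ (ℕₚ.<⇒<ᵇ j<fi))

  diagram-cong : {f g : Fin a → ℕ} → f ≗ g → diagram {b = b} f ≡ diagram g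
  diagram-cong f≗g = Vecₚ.tabulate-cong λ i → cong (λ n → tabulate λ j → toℕ j <ᵇ n) (f≗g i)

  diagram-mono : {f g : Fin a → ℕ} → (∀ i → g i ≤ f i) → diagram {b = b} g ⊆ diagram f
  diagram-mono {f = f} {g} g≤f i j h = ∋-diagram⁺ f (ℕₚ.<-≤-trans (∋-diagram⁻ g h) (g≤f i))

  diagram-mono⁻ : {f g : Fin a → ℕ} → BoundedBy b g → diagram {b = b} g ⊆ diagram f → ∀ i → g i ≤ f i
  diagram-mono⁻ {f = f} {g} g≤b g⊆f i = ℕₚ.≮⇒≥ λ fi<gi →
    let fi<b = ℕₚ.<-≤-trans fi<gi (g≤b i)
        box≡fi = Finₚ.toℕ-fromℕ< fi<b
        box∈g = ∋-diagram⁺ g (subst (_< g i) (sym box≡fi) fi<gi)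
    in <-irrefl box≡fi (∋-diagram⁻ f (g⊆f i (fromℕ< fi<b) box∈g))

  diagram-injective : {f g : Fin a → ℕ} → BoundedBy b f → BoundedBy b g →
                      diagram {b = b} f ≡ diagram g → f ≗ g
  diagram-injective {f = f} {g} f≤b g≤b f≡g i = ≤-antisym
    (diagram-mono⁻ {f = g} f≤b (λ i j → subst (_∋ i , j) f≡g) i)
    (diagram-mono⁻ {f = f} g≤b (λ i j → subst (_∋ i , j) (sym f≡g)) i)

  diagram-isIdeal : {f : Fin a → ℕ} → Antitone f → IsIdeal (diagram {b = b} f)
  diagram-isIdeal {f = f} anti i j i' j' i'≤i j'≤j h =
    ∋-diagram⁺ f (ℕₚ.<-≤-trans (ℕₚ.≤-<-trans j'≤j (∋-diagram⁻ f h)) (anti i'≤i))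

  isIdeal⇒antitone : {f : Fin a → ℕ} → BoundedBy b f → IsIdeal (diagram {b = b} f) → Antitone f
  isIdeal⇒antitone {f = f} f≤b ideal {i} {i'} i'≤i = ℕₚ.≮⇒≥ λ fi'<fi →
    let fi'<b = ℕₚ.<-≤-trans fi'<fi (f≤b i)
        box≡fi' = Finₚ.toℕ-fromℕ< fi'<b
        box∈i = ∋-diagram⁺ f (subst (_< f i) (sym box≡fi') fi'<fi)
    in <-irrefl box≡fi' (∋-diagram⁻ f (ideal i _ i' _ i'≤i ≤-refl box∈i))

  zipWith-tabulate : ∀ {n} {A B C : Set} (h : A → B → C) (f : Fin n → A) (g : Fin n → B) →
                     zipWith h (tabulate f) (tabulate g) ≡ tabulate (λ i → h (f i) (g i))
  zipWith-tabulate {zero}  h f g = refl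
  zipWith-tabulate {suc n} h f g = cong (h (f zero) (g zero) ∷_) (zipWith-tabulate h (f ∘ suc) (g ∘ suc))

  <ᵇ-⊓ : ∀ j m n → ((j <ᵇ m) ∧ (j <ᵇ n)) ≡ (j <ᵇ m ⊓ n)
  <ᵇ-⊓ zero    zero    n       = refl
  <ᵇ-⊓ zero    (suc m) zero    = refl
  <ᵇ-⊓ zero    (suc m) (suc n) = refl
  <ᵇ-⊓ (suc j) zero    n       = refl
  <ᵇ-⊓ (suc j) (suc m) zero    = Boolₚ.∧-zeroʳ _
  <ᵇ-⊓ (suc j) (suc m) (suc n) = <ᵇ-⊓ j m n

  diagram-∩ : (f g : Fin a → ℕ) → diagram {b = b} f ∩ diagram g ≡ diagram (λ i → f i ⊓ g i)
  diagram-∩ f g = trans (zipWith-tabulate _ _ _) (Vecₚ.tabulate-cong λ i →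
    trans (zipWith-tabulate _ _ _) (Vecₚ.tabulate-cong λ j → <ᵇ-⊓ (toℕ j) (f i) (g i)))

  shrink : (Fin a → Bool) → (Fin a → ℕ) → Fin a → ℕ
  shrink R f i = if R i then pred (f i) else f i

  shrink-selected : ∀ R (f : Fin a → ℕ) i → R i ≡ true → shrink R f i ≡ pred (f i)
  shrink-selected R f i Ri rewrite Ri = refl

  shrink-unselected : ∀ R (f : Fin a → ℕ) i → R i ≡ false → shrink R f i ≡ f i
  shrink-unselected R f i Ri rewrite Ri = refl

  shrink-≤ : (R : Fin a → Bool) (f : Fin a → ℕ) → ∀ i → shrink R f i ≤ f i
  shrink-≤ R f i with R i
  ... | true  = ℕₚ.pred[n]≤n
  ... | false = ≤-refl

  shrink-⊓ : (R R' : Fin a → Bool) (f : Fin a → ℕ) →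
             ∀ i → shrink R f i ⊓ shrink R' f i ≡ shrink (λ i → R i ∨ R' i) f i
  shrink-⊓ R R' f i with R i | R' i
  ... | true  | true  = ℕₚ.⊓-idem _
  ... | true  | false = ℕₚ.m≤n⇒m⊓n≡m ℕₚ.pred[n]≤n
  ... | false | true  = ℕₚ.m≥n⇒m⊓n≡n ℕₚ.pred[n]≤n
  ... | false | false = ℕₚ.⊓-idem _

  isRow : Fin a → Fin a → Bool
  isRow r i = does (i Fin.≟ r)

  inRows : List (Fin a) → Fin a → Bool
  inRows rs i = any (λ r → isRow r i) rs

  meet-shrinkRows : (f : Fin a → ℕ) (rs : List (Fin a)) →
    meet (diagram {b = b} f) (map (λ r → diagram (shrink (isRow r) f)) rs) ≡ diagram (shrink (inRows rs) f)
  meet-shrinkRows f []       = refl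
  meet-shrinkRows f (r ∷ rs) = begin
    diagram (shrink (isRow r) f) ∩ meet (diagram f) (map (λ r → diagram (shrink (isRow r) f)) rs)
      ≡⟨ cong (_ ∩_) (meet-shrinkRows f rs) ⟩
    diagram (shrink (isRow r) f) ∩ diagram (shrink (inRows rs) f)
      ≡⟨ diagram-∩ (shrink (isRow r) f) (shrink (inRows rs) f) ⟩
    diagram (λ i → shrink (isRow r) f i ⊓ shrink (inRows rs) f i)
      ≡⟨ diagram-cong (shrink-⊓ (isRow r) (inRows rs) f) ⟩
    diagram (shrink (inRows (r ∷ rs)) f) ∎
    where open ≡-Reasoning

  -- Lattice paths

  -- Paths from the north-east to the south-west corner of the a × b rectangle, read from the
  -- top row down: `south` closes a row of the current width b, `west` narrows the width.
  data Path : ℕ → ℕ → Set where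
    end   : Path 0 0
    south : Path a b → Path (suc a) b
    west  : Path a b → Path a (suc b)

  rowLength : Path a b → Fin a → ℕ
  rowLength (south {b = b} p) zero    = b
  rowLength (south p)         (suc i) = rowLength p i
  rowLength (west p)          i       = rowLength p i

  idealOf : Path a b → Sub a b
  idealOf p = diagram (rowLength p)

  rowLength-bounded : (p : Path a b) → BoundedBy b (rowLength p)
  rowLength-bounded (south p) zero    = ≤-refl
  rowLength-bounded (south p) (suc i) = rowLength-bounded p i
  rowLength-bounded (west p)  i       = ℕₚ.m≤n⇒m≤1+n (rowLength-bounded p i)

  rowLength-antitone : (p : Path a b) → Antitone (rowLength p)
  rowLength-antitone (south p) {zero}  {zero}  _         = ≤-refl
  rowLength-antitone (south p) {suc i} {zero}  _         = rowLength-bounded p i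
  rowLength-antitone (south p) {suc i} {suc _} (s≤s i'≤i) = rowLength-antitone p i'≤i
  rowLength-antitone (west p)                  i'≤i      = rowLength-antitone p i'≤i

  rowLength-injective : (p q : Path a b) → rowLength p ≗ rowLength q → p ≡ q
  rowLength-injective end       end       _ = refl
  rowLength-injective (south p) (south q) e = cong south (rowLength-injective p q (e ∘ suc))
  rowLength-injective (south p) (west q)  e =
    ⊥-elim (ℕₚ.n≮n _ (subst (_≤ _) (sym (e zero)) (rowLength-bounded q zero)))
  rowLength-injective (west p)  (south q) e =
    ⊥-elim (ℕₚ.n≮n _ (subst (_≤ _) (e zero) (rowLength-bounded p zero)))
  rowLength-injective (west p)  (west q)  e = cong west (rowLength-injective p q e)

  idealOf-injective : (p q : Path a b) → idealOf p ≡ idealOf q → p ≡ q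
  idealOf-injective p q e =
    rowLength-injective p q (diagram-injective (rowLength-bounded p) (rowLength-bounded q) e)

  idealOf-isIdeal : (p : Path a b) → IsIdeal (idealOf p)
  idealOf-isIdeal p = diagram-isIdeal (rowLength-antitone p)

  wests : ∀ b → Path 0 b
  wests zero    = end
  wests (suc b) = west (wests b)

  pathWithRowLengths : (f : Fin a → ℕ) → Antitone f → BoundedBy b f →
                       Σ (Path a b) λ p → rowLength p ≗ f
  pathWithRowLengths {zero} {b} f _ _ = wests b , λ ()
  pathWithRowLengths {suc a} {b} f anti f≤b with f zero ℕ.≟ b
  ... | yes f0≡b =
    let p , e = pathWithRowLengths (f ∘ suc) (λ i'≤i → anti (s≤s i'≤i)) (f≤b ∘ suc)
    in south p , λ { zero → sym f0≡b ; (suc i) → e i }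
  pathWithRowLengths {suc a} {zero}  f anti f≤b | no f0≢0 = contradiction (ℕₚ.n≤0⇒n≡0 (f≤b zero)) f0≢0
  pathWithRowLengths {suc a} {suc b} f anti f≤b | no f0≢b =
    let f0≤b = ℕₚ.≤-pred (ℕₚ.≤∧≢⇒< (f≤b zero) f0≢b)
        p , e = pathWithRowLengths f anti (λ i → ≤-trans (anti z≤n) f0≤b)
    in west p , e

  leadingTrues : ∀ {n} → Vec Bool n → ℕ
  leadingTrues []          = 0
  leadingTrues (true ∷ r)  = suc (leadingTrues r)
  leadingTrues (false ∷ r) = 0

  leadingTrues-bounded : ∀ {n} (r : Vec Bool n) → leadingTrues r ≤ n
  leadingTrues-bounded []          = z≤n
  leadingTrues-bounded (true ∷ r)  = s≤s (leadingTrues-bounded r)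
  leadingTrues-bounded (false ∷ r) = z≤n

  downClosed-row : ∀ {n} (r : Vec Bool n) →
                   (∀ {j j'} → j' Fin.≤ j → lookup r j ≡ true → lookup r j' ≡ true) →
                   ∀ j → lookup r j ≡ (toℕ j <ᵇ leadingTrues r)
  downClosed-row (true ∷ r)  closed zero    = refl
  downClosed-row (true ∷ r)  closed (suc j) = downClosed-row r (λ j'≤j → closed (s≤s j'≤j)) j
  downClosed-row (false ∷ r) closed zero    = refl
  downClosed-row (false ∷ r) closed (suc j) with lookup r j in rj
  ... | true  = sym (closed {suc j} {zero} z≤n rj)
  ... | false = refl

  isIdeal⇒diagram : (x : Sub a b) → IsIdeal x → x ≡ diagram (leadingTrues ∘ lookup x)
  isIdeal⇒diagram x ideal = trans (sym (Vecₚ.tabulate∘lookup x)) (Vecₚ.tabulate-cong λ i →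
    trans (sym (Vecₚ.tabulate∘lookup (lookup x i)))
          (Vecₚ.tabulate-cong (downClosed-row (lookup x i) (ideal i _ i _ ≤-refl))))

  idealOf-surjective : (x : Sub a b) → IsIdeal x → Σ (Path a b) λ p → x ≡ idealOf p
  idealOf-surjective x ideal =
    let f     = leadingTrues ∘ lookup x
        x≡f   = isIdeal⇒diagram x ideal
        f≤b   = λ i → leadingTrues-bounded (lookup x i)
        anti  = isIdeal⇒antitone f≤b (subst IsIdeal x≡f ideal)
        p , e = pathWithRowLengths f anti f≤b
    in p , trans x≡f (diagram-cong (sym ∘ e))

  -- Covers and corners

  IsCorner : (Fin a → ℕ) → Fin a → Set
  IsCorner f r = 0 < f r × (∀ i → r Fin.< i → f i < f r)

  module _ (f : Fin a → ℕ) (r : Fin a) where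

    shrinkRow-at : shrink (isRow r) f r ≡ pred (f r)
    shrinkRow-at = shrink-selected (isRow r) f r (dec-true (r Fin.≟ r) refl)

    shrinkRow-off : ∀ {i} → i ≢ r → shrink (isRow r) f i ≡ f i
    shrinkRow-off {i} i≢r = shrink-unselected (isRow r) f i (dec-false (i Fin.≟ r) i≢r)

    shrinkRow-antitone : Antitone f → IsCorner f r → Antitone (shrink (isRow r) f)
    shrinkRow-antitone anti (_ , below) {i} {i'} i'≤i with i Fin.≟ r | i' Fin.≟ r
    ... | yes refl | yes refl = ≤-refl
    ... | yes refl | no _     = ≤-trans ℕₚ.pred[n]≤n (anti i'≤i)
    ... | no i≢r   | yes refl =
      ℕₚ.suc[m]≤n⇒m≤pred[n] (below i (ℕₚ.≤∧≢⇒< i'≤i (i≢r ∘ sym ∘ Finₚ.toℕ-injective)))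
    ... | no _     | no _     = anti i'≤i

    between-shrinkRow : {g : Fin a → ℕ} → (∀ i → shrink (isRow r) f i ≤ g i) → (∀ i → g i ≤ f i) →
                        g ≗ f ⊎ g ≗ shrink (isRow r) f
    between-shrinkRow {g} h≤g g≤f with g r ℕ.≟ f r
    ... | yes gr≡fr = inj₁ g≗f
      where
      g≗f : g ≗ f
      g≗f i with i Fin.≟ r
      ... | yes refl = gr≡fr
      ... | no i≢r   = ≤-antisym (g≤f i) (subst (_≤ g i) (shrinkRow-off i≢r) (h≤g i))
    ... | no gr≢fr = inj₂ g≗h
      where
      g≗h : g ≗ shrink (isRow r) f
      g≗h i with i Fin.≟ r
      ... | yes refl = ≤-antisym (ℕₚ.<⇒≤pred (ℕₚ.≤∧≢⇒< (g≤f i) gr≢fr)) (subst (_≤ g i) shrinkRow-at (h≤g i))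
      ... | no i≢r   = ≤-antisym (g≤f i) (subst (_≤ g i) (shrinkRow-off i≢r) (h≤g i))

  splice : Fin a → (Fin a → ℕ) → (Fin a → ℕ) → Fin a → ℕ
  splice r f g i = if does (i Fin.≤? r) then f i else g i

  module _ (r : Fin a) {f g : Fin a → ℕ} where

    splice-upTo : ∀ {i} → i Fin.≤ r → splice r f g i ≡ f i
    splice-upTo {i} i≤r rewrite dec-true (i Fin.≤? r) i≤r = refl

    splice-after : ∀ {i} → ¬ i Fin.≤ r → splice r f g i ≡ g i
    splice-after {i} i≰r rewrite dec-false (i Fin.≤? r) i≰r = refl

    ≤-splice : (∀ i → g i ≤ f i) → ∀ i → g i ≤ splice r f g i
    ≤-splice g≤f i with i Fin.≤? r
    ... | yes i≤r = subst (g i ≤_) (sym (splice-upTo i≤r)) (g≤f i)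
    ... | no i≰r  = ℕₚ.≤-reflexive (sym (splice-after i≰r))

    splice-≤ : (∀ i → g i ≤ f i) → ∀ i → splice r f g i ≤ f i
    splice-≤ g≤f i with i Fin.≤? r
    ... | yes i≤r = ℕₚ.≤-reflexive (splice-upTo i≤r)
    ... | no i≰r  = subst (_≤ f i) (sym (splice-after i≰r)) (g≤f i)

    splice-antitone : Antitone f → Antitone g → (∀ i → g i ≤ f i) → Antitone (splice r f g)
    splice-antitone f-anti g-anti g≤f {i} {i'} i'≤i with i Fin.≤? r | i' Fin.≤? r
    ... | yes i≤r | yes i'≤r = subst₂ _≤_ (sym (splice-upTo i≤r)) (sym (splice-upTo i'≤r)) (f-anti i'≤i)
    ... | yes i≤r | no i'≰r  = ⊥-elim (i'≰r (≤-trans i'≤i i≤r))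
    ... | no i≰r  | yes i'≤r = subst₂ _≤_ (sym (splice-after i≰r)) (sym (splice-upTo i'≤r))
                                 (≤-trans (g≤f i) (f-anti i'≤i))
    ... | no i≰r  | no i'≰r  = subst₂ _≤_ (sym (splice-after i≰r)) (sym (splice-after i'≰r)) (g-anti i'≤i)

  _≟ˢ_ : DecidableEquality (Sub a b)
  _≟ˢ_ = Vecₚ.≡-dec (Vecₚ.≡-dec Boolₚ._≟_)

  ⋖-squeeze : {t x z : Sub a b} → t ⋖ x → IsIdeal z → t ⊆ z → z ⊆ x → z ≡ t ⊎ z ≡ x
  ⋖-squeeze {t = t} {x} {z} (_ , _ , nothingBetween) z-ideal t⊆z z⊆x with z ≟ˢ t | z ≟ˢ x
  ... | yes z≡t | _       = inj₁ z≡t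
  ... | no _    | yes z≡x = inj₂ z≡x
  ... | no z≢t  | no z≢x  = ⊥-elim (nothingBetween z z-ideal (t⊆z , z≢t ∘ sym) (z⊆x , z≢x))

  module _ {b} {f : Fin a → ℕ} (anti : Antitone f) (f≤b : BoundedBy b f) where

    shrink-bounded : ∀ R → BoundedBy b (shrink R f)
    shrink-bounded R i = ≤-trans (shrink-≤ R f i) (f≤b i)

    shrinkRow-⊂ : ∀ {r} → IsCorner f r → diagram {b = b} (shrink (isRow r) f) ⊂ diagram f
    shrinkRow-⊂ {r} (fr>0 , _) = diagram-mono (shrink-≤ (isRow r) f) , λ e →
      pred≢ fr>0 (trans (sym (shrinkRow-at f r)) (diagram-injective (shrink-bounded (isRow r)) f≤b e r))
      where
      pred≢ : ∀ {n} → 0 < n → pred n ≢ n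
      pred≢ (s≤s _) = ℕₚ.1+n≢n ∘ sym

    shrinkRow-⋖ : ∀ {r} → IsCorner f r → diagram {b = b} (shrink (isRow r) f) ⋖ diagram f
    shrinkRow-⋖ {r} corner =
      diagram-isIdeal (shrinkRow-antitone f r anti corner) , shrinkRow-⊂ corner , nothingBetween
      where
      nothingBetween : ∀ z → IsIdeal z → diagram (shrink (isRow r) f) ⊂ z → z ⊂ diagram f → ⊥
      nothingBetween z z-ideal (h⊆z , h≢z) (z⊆f , z≢f) with idealOf-surjective z z-ideal
      ... | q , refl with between-shrinkRow f r
                            (diagram-mono⁻ {f = rowLength q} (shrink-bounded (isRow r)) h⊆z)
                            (diagram-mono⁻ {f = f} (rowLength-bounded q) z⊆f)
      ...   | inj₁ g≗f = z≢f (diagram-cong g≗f)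
      ...   | inj₂ g≗h = h≢z (sym (diagram-cong g≗h))

    -- Splicing f (rows up to r) onto g gives an ideal strictly above diagram g, so the cover
    -- forces it to be diagram f.
    ⋖-agreesAfter : ∀ {g r} → Antitone g → BoundedBy b g → (∀ i → g i ≤ f i) → g r < f r →
                    diagram {b = b} g ⋖ diagram f → ∀ i → r Fin.< i → g i ≡ f i
    ⋖-agreesAfter {g} {r} g-anti g≤b g≤f gr<fr cover i r<i =
      trans (sym (splice-after r {f} {g} (ℕₚ.<⇒≱ r<i))) (diagram-injective spliced≤b f≤b spliced≡f i)
      where
      spliced≤b : BoundedBy b (splice r f g)
      spliced≤b i = ≤-trans (splice-≤ r g≤f i) (f≤b i)

      spliced≡f : diagram (splice r f g) ≡ diagram f
      spliced≡f with ⋖-squeeze cover (diagram-isIdeal (splice-antitone r anti g-anti g≤f))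
                                     (diagram-mono (≤-splice r g≤f)) (diagram-mono (splice-≤ r g≤f))
      ... | inj₂ e = e
      ... | inj₁ e = ⊥-elim (ℕₚ.<⇒≢ gr<fr
                       (trans (sym (diagram-injective spliced≤b g≤b e r)) (splice-upTo r {f} {g} ≤-refl)))

    ⋖⇒shrinkRow′ : ∀ {g} → Antitone g → BoundedBy b g → diagram {b = b} g ⋖ diagram f →
                   Σ (Fin a) λ r → IsCorner f r × diagram g ≡ diagram (shrink (isRow r) f)
    ⋖⇒shrinkRow′ {g} g-anti g≤b cover@(_ , (g⊆f , g≢f) , _) with Finₚ.any? (λ i → g i ℕ.<? f i)
    ... | no ∄r = ⊥-elim (g≢f (diagram-cong λ i → ≤-antisym (g≤f i) (ℕₚ.≮⇒≥ λ gi<fi → ∄r (i , gi<fi))))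
      where
      g≤f : ∀ i → g i ≤ f i
      g≤f = diagram-mono⁻ {f = f} g≤b g⊆f
    ... | yes (r , gr<fr) = r , corner , sym shrunk≡g
      where
      g≤f : ∀ i → g i ≤ f i
      g≤f = diagram-mono⁻ {f = f} g≤b g⊆f

      agree : ∀ i → r Fin.< i → g i ≡ f i
      agree = ⋖-agreesAfter g-anti g≤b g≤f gr<fr cover

      corner : IsCorner f r
      corner = ℕₚ.≤-<-trans z≤n gr<fr , λ i r<i →
        subst (_< f r) (agree i r<i) (ℕₚ.≤-<-trans (g-anti (ℕₚ.<⇒≤ r<i)) gr<fr)

      g≤shrunk : ∀ i → g i ≤ shrink (isRow r) f i
      g≤shrunk i with i Fin.≟ r
      ... | yes refl = ℕₚ.<⇒≤pred gr<fr
      ... | no _     = g≤f i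

      shrunk≡g : diagram (shrink (isRow r) f) ≡ diagram g
      shrunk≡g with ⋖-squeeze cover (diagram-isIdeal (shrinkRow-antitone f r anti corner))
                                    (diagram-mono g≤shrunk) (proj₁ (shrinkRow-⊂ corner))
      ... | inj₁ e = e
      ... | inj₂ e = ⊥-elim (proj₂ (shrinkRow-⊂ corner) e)

    ⋖⇒shrinkRow : ∀ {t} → t ⋖ diagram {b = b} f →
                  Σ (Fin a) λ r → IsCorner f r × t ≡ diagram (shrink (isRow r) f)
    ⋖⇒shrinkRow {t} cover@(t-ideal , _) with idealOf-surjective t t-ideal
    ... | q , refl = ⋖⇒shrinkRow′ (rowLength-antitone q) (rowLength-bounded q) cover

  -- Ungar moves as corner flips

  -- A move that flips some corners SW of the path into WS, each flip removing the last box of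
  -- its row; the flag records whether anything was flipped.
  data Swap : Path a b → Path a b → Bool → Set where
    none  : Swap end end false
    south : ∀ {p p' : Path a b} {m} → Swap p p' m → Swap (south p) (south p') m
    west  : ∀ {p p' : Path a b} {m} → Swap p p' m → Swap (west p) (west p') m
    flip  : ∀ {p p' : Path a b} {m} → Swap p p' m → Swap (south (west p)) (west (south p')) true

  noSwap : (p : Path a b) → Swap p p false
  noSwap end       = none
  noSwap (south p) = south (noSwap p)
  noSwap (west p)  = west (noSwap p)

  flippedRows : ∀ {p p' : Path a b} {m} → Swap p p' m → List (Fin a)
  flippedRows none     = []
  flippedRows (south s) = map suc (flippedRows s)
  flippedRows (west s)  = flippedRows s
  flippedRows (flip s)  = zero ∷ map suc (flippedRows s)

  inRows-zero : ∀ (rs : List (Fin a)) → inRows (map suc rs) zero ≡ false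
  inRows-zero []       = refl
  inRows-zero (r ∷ rs) = inRows-zero rs

  inRows-suc : ∀ (rs : List (Fin a)) i → inRows (map suc rs) (suc i) ≡ inRows rs i
  inRows-suc []       i = refl
  inRows-suc (r ∷ rs) i = cong (isRow r i ∨_) (inRows-suc rs i)

  inRows-self : ∀ (r : Fin a) rs → inRows (r ∷ rs) r ≡ true
  inRows-self r rs rewrite dec-true (r Fin.≟ r) refl = refl

  swap-rowLength : ∀ {p p' : Path a b} {m} (s : Swap p p' m) →
                   rowLength p' ≗ shrink (inRows (flippedRows s)) (rowLength p)
  swap-rowLength (south {b = b} s) zero =
    cong (λ x → if x then pred b else b) (sym (inRows-zero (flippedRows s)))
  swap-rowLength {p = south p} (south s) (suc i) = trans (swap-rowLength s i)
    (cong (λ x → if x then pred (rowLength p i) else rowLength p i) (sym (inRows-suc (flippedRows s) i)))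
  swap-rowLength (west s) i = swap-rowLength s i
  swap-rowLength (flip s) zero = refl
  swap-rowLength {p = south (west p)} (flip s) (suc i) = trans (swap-rowLength s i)
    (cong (λ x → if x then pred (rowLength p i) else rowLength p i) (sym (inRows-suc (flippedRows s) i)))

  corner-south⁻ : ∀ {p : Path a b} {r} → IsCorner (rowLength (south p)) (suc r) → IsCorner (rowLength p) r
  corner-south⁻ (pos , after) = pos , λ i r<i → after (suc i) (s≤s r<i)

  corner-south⁺ : ∀ {p : Path a b} {r} → IsCorner (rowLength p) r → IsCorner (rowLength (south p)) (suc r)
  corner-south⁺ (pos , after) = pos , λ { zero () ; (suc i) (s≤s r<i) → after i r<i }

  corner-flip : ∀ {p : Path a b} → IsCorner (rowLength (south (west p))) zero
  corner-flip {p = p} = s≤s z≤n , λ { zero () ; (suc i) _ → s≤s (rowLength-bounded p i) }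

  flippedRows-corners : ∀ {p p' : Path a b} {m} (s : Swap p p' m) → All (IsCorner (rowLength p)) (flippedRows s)
  flippedRows-corners none      = []
  flippedRows-corners (south s) = Allₚ.map⁺ (All.map corner-south⁺ (flippedRows-corners s))
  flippedRows-corners (west s)  = flippedRows-corners s
  flippedRows-corners (flip s)  = corner-flip ∷ Allₚ.map⁺ (All.map corner-south⁺ (flippedRows-corners s))

  map-nonempty : ∀ {A B : Set} (g : A → B) {xs} → xs ≢ [] → map g xs ≢ []
  map-nonempty g {[]}    xs≢[] = contradiction refl xs≢[]
  map-nonempty g {_ ∷ _} _     = λ ()

  flippedRows-nonempty : ∀ {p p' : Path a b} (s : Swap p p' true) → flippedRows s ≢ []
  flippedRows-nonempty (south s) = map-nonempty suc (flippedRows-nonempty s)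
  flippedRows-nonempty (west s)  = flippedRows-nonempty s
  flippedRows-nonempty (flip s)  = λ ()

  record SwapOf (p : Path a b) (R : Fin a → Bool) : Set where
    constructor swapOf
    field
      {target}       : Path a b
      {moved}        : Bool
      swap           : Swap p target moved
      lengths        : rowLength target ≗ shrink R (rowLength p)
      selected⇒moved : ∀ i → T (R i) → T moved

  module _ {p p' : Path a b} {R : Fin (suc a) → Bool} where

    lengths-keepTop : rowLength p' ≗ shrink (R ∘ suc) (rowLength p) → R zero ≡ false →
                      rowLength (south p') ≗ shrink R (rowLength (south p))
    lengths-keepTop _       R0 zero    = sym (shrink-unselected R (rowLength (south p)) zero R0)
    lengths-keepTop lengths _  (suc i) = lengths i

    lengths-flipTop : rowLength p' ≗ shrink (R ∘ suc) (rowLength p) → R zero ≡ true →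
                      rowLength (west (south p')) ≗ shrink R (rowLength (south (west p)))
    lengths-flipTop _       R0 zero    = sym (shrink-selected R (rowLength (south (west p))) zero R0)
    lengths-flipTop lengths _  (suc i) = lengths i

  selected-keepTop : ∀ {R : Fin (suc a) → Bool} {m} → (∀ i → T (R (suc i)) → T m) → R zero ≡ false →
                     ∀ i → T (R i) → T m
  selected-keepTop _   R0 zero    selected = ⊥-elim (subst T R0 selected)
  selected-keepTop sel _  (suc i) = sel i

  southSwap : (p : Path a b) (R : Fin (suc a) → Bool) → (∀ r → T (R r) → IsCorner (rowLength (south p)) r) →
              ∀ x → R zero ≡ x → SwapOf (south p) R

  swapSelected : (p : Path a b) (R : Fin a → Bool) → (∀ r → T (R r) → IsCorner (rowLength p) r) → SwapOf p R
  swapSelected end       R corners = swapOf none (λ ()) (λ ())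
  swapSelected (west p)  R corners =
    let swapOf s lengths sel = swapSelected p R corners in swapOf (west s) lengths sel
  swapSelected (south p) R corners = southSwap p R corners (R zero) refl

  southSwap end R corners true R0 = ⊥-elim (ℕₚ.n≮0 (proj₁ (corners zero (subst T (sym R0) _))))
  southSwap end R corners false R0 =
    swapOf (south none) (lengths-keepTop (λ ()) R0) (selected-keepTop (λ ()) R0)
  southSwap (south p) R corners true R0 =
    ⊥-elim (ℕₚ.n≮n _ (proj₂ (corners zero (subst T (sym R0) _)) (suc zero) (s≤s z≤n)))
  southSwap (south p) R corners false R0 =
    let swapOf s lengths sel = swapSelected (south p) (R ∘ suc) (λ r → corner-south⁻ ∘ corners (suc r))
    in swapOf (south s) (lengths-keepTop lengths R0) (selected-keepTop sel R0)
  southSwap (west p) R corners true R0 =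
    let swapOf s lengths _ = swapSelected p (R ∘ suc) (λ r → corner-south⁻ ∘ corners (suc r))
    in swapOf (flip s) (lengths-flipTop lengths R0) (λ _ _ → _)
  southSwap (west p) R corners false R0 =
    let swapOf s lengths sel = swapSelected (west p) (R ∘ suc) (λ r → corner-south⁻ ∘ corners (suc r))
    in swapOf (south s) (lengths-keepTop lengths R0) (selected-keepTop sel R0)

  coversAt : (p : Path a b) → List (Fin a) → List (Sub a b)
  coversAt p = map λ r → diagram (shrink (isRow r) (rowLength p))

  swap→ungar : ∀ {p p' : Path a b} → Swap p p' true → UngarMove (idealOf p) (idealOf p')
  swap→ungar {p = p} {p'} s =
    coversAt p rs , map-nonempty _ (flippedRows-nonempty s) ,
    Allₚ.map⁺ (All.map (shrinkRow-⋖ (rowLength-antitone p) (rowLength-bounded p)) (flippedRows-corners s)) ,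
    trans (diagram-cong (swap-rowLength s)) (sym (meet-shrinkRows (rowLength p) rs))
    where rs = flippedRows s

  coverRows : (p : Path a b) (ts : List (Sub a b)) → All (_⋖ idealOf p) ts →
              Σ (List (Fin a)) λ rs → All (IsCorner (rowLength p)) rs × ts ≡ coversAt p rs
  coverRows p []       []       = [] , [] , refl
  coverRows p (t ∷ ts) (c ∷ cs) =
    let r  , corner  , t≡  = ⋖⇒shrinkRow (rowLength-antitone p) (rowLength-bounded p) c
        rs , corners , ts≡ = coverRows p ts cs
    in r ∷ rs , corner ∷ corners , cong₂ _∷_ t≡ ts≡

  inRows-corner : ∀ {f : Fin a → ℕ} {rs} → All (IsCorner f) rs → ∀ r → T (inRows rs r) → IsCorner f r
  inRows-corner {rs = r' ∷ _} (c ∷ cs) r selected with r Fin.≟ r'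
  ... | yes refl = c
  ... | no _     = inRows-corner cs r selected

  someRow⇒moved : ∀ (rs : List (Fin a)) {m} → rs ≢ [] → (∀ i → T (inRows rs i) → T m) → T m
  someRow⇒moved []      rs≢[] _   = contradiction refl rs≢[]
  someRow⇒moved (r ∷ rs) _    sel = sel r (Equivalence.from Boolₚ.T-≡ (inRows-self r rs))

  ungar→swap : ∀ (p : Path a b) {y} → UngarMove (idealOf p) y →
               Σ (Path a b) λ p' → Swap p p' true × y ≡ idealOf p'
  ungar→swap p {y} (ts , ts≢[] , covers , y≡meet) with coverRows p ts covers
  ... | rs , corners , refl = target , subst (Swap p target) moved≡true swap , y≡target
    where
    open SwapOf (swapSelected p (inRows rs) (inRows-corner corners))

    moved≡true : moved ≡ true
    moved≡true = Equivalence.to Boolₚ.T-≡ (someRow⇒moved rs (ts≢[] ∘ cong (coversAt p)) selected⇒moved)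

    y≡target : y ≡ idealOf target
    y≡target = trans y≡meet (trans (meet-shrinkRows (rowLength p) rs) (diagram-cong (sym ∘ lengths)))

  -- The automaton

  -- `explore` merely proposes a candidate for the set of reachable states; `closed?` certifies it.
  explore : {A : Set} → DecidableEquality A → (A → List A) → ℕ → List A → List A
  explore _≟_ next zero    xs = xs
  explore _≟_ next (suc n) xs = explore _≟_ next n (deduplicate _≟_ (xs ++ concatMap next xs))

  Closed : {A : Set} → (A → List A) → List A → Set
  Closed next xs = All (λ x → All (_∈ xs) (next x)) xs

  closed? : {A : Set} → DecidableEquality A → (next : A → List A) → ∀ xs → Dec (Closed next xs)
  closed? _≟_ next xs = All.all? (λ x → All.all? (λ y → Membership._∈?_ _≟_ y xs) (next x)) xs

  -- Reading S for south and W for west, the automaton below accepts from q0 exactly the words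
  -- of (W | S((WW)⁺S)*S)* (S((WW)⁺S)*(WW)*)? ; q3 is a dead state.
  State : Set
  State = Fin 5

  pattern q0 = zero
  pattern q1 = suc zero
  pattern q2 = suc (suc zero)
  pattern q3 = suc (suc (suc zero))
  pattern q4 = suc (suc (suc (suc zero)))

  readSouth : State → State
  readSouth q0 = q1
  readSouth q1 = q0
  readSouth q2 = q3
  readSouth q3 = q3
  readSouth q4 = q1

  readWest : State → State
  readWest q0 = q0
  readWest q1 = q2
  readWest q2 = q4
  readWest q3 = q3
  readWest q4 = q2

  accepting : State → Bool
  accepting q0 = true
  accepting q1 = true
  accepting q2 = false
  accepting q3 = false
  accepting q4 = true

  run : State → Path a b → State
  run q end       = q
  run q (south p) = run (readSouth q) p
  run q (west p)  = run (readWest q) p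

  AcceptedFrom : State → Path a b → Set
  AcceptedFrom q p = T (accepting (run q p))

  Accepted : Path a b → Set
  Accepted = AcceptedFrom q0

  -- States reached when reading a path and one of its swaps side by side, together with
  -- whether a flip has occurred so far; `flip` reads SW on the left against WS on the right.
  Configuration : Set
  Configuration = State × State × Bool

  _≟ᶜ_ : DecidableEquality Configuration
  _≟ᶜ_ = ×ₚ.≡-dec Finₚ._≟_ (×ₚ.≡-dec Finₚ._≟_ Boolₚ._≟_)

  readSwap : Configuration → List Configuration
  readSwap (q , q' , g) = (readSouth q , readSouth q' , g)
                        ∷ (readWest q , readWest q' , g)
                        ∷ (readWest (readSouth q) , readSouth (readWest q') , true)
                        ∷ []

  jointRuns : List Configuration
  jointRuns = explore _≟ᶜ_ readSwap 5 ((q0 , q0 , false) ∷ [])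

  jointRuns-closed : Closed readSwap jointRuns
  jointRuns-closed = from-yes (closed? _≟ᶜ_ readSwap jointRuns)

  jointRuns-safe : All (λ { (q , q' , g) → T (not (g ∧ accepting q ∧ accepting q')) }) jointRuns
  jointRuns-safe =
    from-yes (All.all? (λ { (q , q' , g) → T? (not (g ∧ accepting q ∧ accepting q')) }) jointRuns)

  jointRuns-swap : ∀ {p p' : Path a b} {m} → Swap p p' m → ∀ {q q' g} → (q , q' , g) ∈ jointRuns →
                   (run q p , run q' p' , g ∨ m) ∈ jointRuns
  jointRuns-swap none {q} {q'} {g} c∈ = subst (λ x → (q , q' , x) ∈ jointRuns) (sym (Boolₚ.∨-identityʳ g)) c∈
  jointRuns-swap (south s) c∈ = jointRuns-swap s (All.lookup (All.lookup jointRuns-closed c∈) (here refl))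
  jointRuns-swap (west s)  c∈ = jointRuns-swap s (All.lookup (All.lookup jointRuns-closed c∈) (there (here refl)))
  jointRuns-swap {p = south (west p)} {west (south p')} (flip s) {q} {q'} {g} c∈ =
    subst (λ x → (run q (south (west p)) , run q' (west (south p')) , x) ∈ jointRuns) (sym (Boolₚ.∨-zeroʳ g))
          (jointRuns-swap s (All.lookup (All.lookup jointRuns-closed c∈) (there (there (here refl)))))

  swap-unaccepts : ∀ {p p' : Path a b} → Swap p p' true → Accepted p → ¬ Accepted p'
  swap-unaccepts {p = p} {p'} s = notBoth (All.lookup jointRuns-safe (jointRuns-swap s (here refl)))
    where
    notBoth : ∀ {x y} → T (not (true ∧ x ∧ y)) → T x → ¬ T y
    notBoth {true} {true} ()

  -- Read backwards, a path is summarised by three tables indexed by the starting state q: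
  -- whether the path is accepted from q, whether some nontrivial swap of it is, and, when the
  -- path is `west p`, whether p or some swap of p is (the information a flip in front needs).
  record Summary : Set where
    constructor ⟨_,_,_⟩
    field
      accepts escapes afterWest : Vec Bool 5

  open Summary

  _≟ᵗ_ : DecidableEquality Summary
  ⟨ a , e , w ⟩ ≟ᵗ ⟨ a' , e' , w' ⟩ =
    map′ (λ { (refl , refl , refl) → refl }) (λ { refl → refl , refl , refl })
         (a ≟ᵛ a' ×-dec e ≟ᵛ e' ×-dec w ≟ᵛ w')
    where _≟ᵛ_ = Vecₚ.≡-dec Boolₚ._≟_

  endSummary : Summary
  endSummary = ⟨ tabulate accepting , replicate 5 false , replicate 5 false ⟩

  southEscapes : Summary → State → Bool
  southEscapes s q = lookup (escapes s) (readSouth q) ∨ lookup (afterWest s) (readSouth (readWest q))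

  westAfterWest : Summary → State → Bool
  westAfterWest s q = lookup (accepts s) q ∨ lookup (escapes s) q

  southSummary : Summary → Summary
  southSummary s = ⟨ tabulate (lookup (accepts s) ∘ readSouth)
                   , tabulate (southEscapes s)
                   , replicate 5 false ⟩

  westSummary : Summary → Summary
  westSummary s = ⟨ tabulate (lookup (accepts s) ∘ readWest)
                  , tabulate (lookup (escapes s) ∘ readWest)
                  , tabulate (westAfterWest s) ⟩

  summarise : Path a b → Summary
  summarise end       = endSummary
  summarise (south p) = southSummary (summarise p)
  summarise (west p)  = westSummary (summarise p)

  readBack : Summary → List Summary
  readBack s = southSummary s ∷ westSummary s ∷ []

  summaries : List Summary
  summaries = explore _≟ᵗ_ readBack 5 (endSummary ∷ [])

  summaries-closed : Closed readBack summaries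
  summaries-closed = from-yes (closed? _≟ᵗ_ readBack summaries)

  summaries-winnable : All (λ s → T (lookup (accepts s) q0 ∨ lookup (escapes s) q0)) summaries
  summaries-winnable =
    from-yes (All.all? (λ s → T? (lookup (accepts s) q0 ∨ lookup (escapes s) q0)) summaries)

  summarise-∈ : (p : Path a b) → summarise p ∈ summaries
  summarise-∈ end       = here refl
  summarise-∈ (south p) = All.lookup (All.lookup summaries-closed (summarise-∈ p)) (here refl)
  summarise-∈ (west p)  = All.lookup (All.lookup summaries-closed (summarise-∈ p)) (there (here refl))

  accepts-summarise : (p : Path a b) → ∀ q → lookup (accepts (summarise p)) q ≡ accepting (run q p)
  accepts-summarise end       q = Vecₚ.lookup∘tabulate accepting q
  accepts-summarise (south p) q =
    trans (Vecₚ.lookup∘tabulate (lookup (accepts (summarise p)) ∘ readSouth) q) (accepts-summarise p (readSouth q))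
  accepts-summarise (west p)  q =
    trans (Vecₚ.lookup∘tabulate (lookup (accepts (summarise p)) ∘ readWest) q) (accepts-summarise p (readWest q))

  AcceptingSwap : State → Path a b → Set
  AcceptingSwap {a} {b} q p = Σ (Path a b) λ p' → Swap p p' true × AcceptedFrom q p'

  private
    T-lookup∘tabulate : ∀ {n} (f : Fin n → Bool) i → T (lookup (tabulate f) i) → T (f i)
    T-lookup∘tabulate f i = subst T (Vecₚ.lookup∘tabulate f i)

    T-lookup-replicate : ∀ (i : State) → ¬ T (lookup (replicate 5 false) i)
    T-lookup-replicate i = subst T (Vecₚ.lookup-replicate i false)

    T-∨⁻ : ∀ {x y} → T (x ∨ y) → T x ⊎ T y
    T-∨⁻ = Equivalence.to Boolₚ.T-∨

  afterWest-sound : (p : Path a b) → ∀ q →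
                    T (lookup (afterWest (summarise p)) (readSouth (readWest q))) → AcceptingSwap q (south p)

  escapes-sound : (p : Path a b) → ∀ q → T (lookup (escapes (summarise p)) q) → AcceptingSwap q p
  escapes-sound end       q h = ⊥-elim (T-lookup-replicate q h)
  escapes-sound (west p)  q h =
    let p' , s , accepted = escapes-sound p (readWest q)
                              (T-lookup∘tabulate (lookup (escapes (summarise p)) ∘ readWest) q h)
    in west p' , west s , accepted
  escapes-sound (south p) q h with T-∨⁻ (T-lookup∘tabulate (southEscapes (summarise p)) q h)
  ... | inj₁ escape =
    let p' , s , accepted = escapes-sound p (readSouth q) escape
    in south p' , south s , accepted
  ... | inj₂ flipTop = afterWest-sound p q flipTop

  afterWest-sound end       q h = ⊥-elim (T-lookup-replicate (readSouth (readWest q)) h)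
  afterWest-sound (south p) q h = ⊥-elim (T-lookup-replicate (readSouth (readWest q)) h)
  afterWest-sound (west p)  q h with T-∨⁻ (T-lookup∘tabulate (westAfterWest (summarise p)) _ h)
  ... | inj₁ accepted = west (south p) , flip (noSwap p) , subst T (accepts-summarise p _) accepted
  ... | inj₂ escape   =
    let p' , s , accepted = escapes-sound p _ escape
    in west (south p') , flip s , accepted

  rejected⇒acceptingSwap : (p : Path a b) → ¬ Accepted p → AcceptingSwap q0 p
  rejected⇒acceptingSwap p rejected with T-∨⁻ (All.lookup summaries-winnable (summarise-∈ p))
  ... | inj₁ accepted = ⊥-elim (rejected (subst T (accepts-summarise p q0) accepted))
  ... | inj₂ escape   = escapes-sound p q0 escape

  -- Eeta wins

  size : Path a b → ℕ
  size end               = 0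
  size (south {b = b} p) = b + size p
  size (west p)          = size p

  swap-size-≤ : ∀ {p p' : Path a b} {m} → Swap p p' m → size p' ≤ size p
  swap-size-≤ none              = z≤n
  swap-size-≤ (south {b = b} s) = ℕₚ.+-monoʳ-≤ b (swap-size-≤ s)
  swap-size-≤ (west s)          = swap-size-≤ s
  swap-size-≤ (flip {b = b} s)  = ℕₚ.m≤n⇒m≤1+n (ℕₚ.+-monoʳ-≤ b (swap-size-≤ s))

  swap-size-< : ∀ {p p' : Path a b} → Swap p p' true → size p' < size p
  swap-size-< (south {b = b} s) = ℕₚ.+-monoʳ-< b (swap-size-< s)
  swap-size-< (west s)          = swap-size-< s
  swap-size-< (flip {b = b} s)  = s≤s (ℕₚ.+-monoʳ-≤ b (swap-size-≤ s))

  eetaWin-atnissWin-exclusive : ∀ {x : Sub a b} → EetaWin x → AtnissWin x → ⊥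
  eetaWin-atnissWin-exclusive (eeta allMoves) (atniss y move y-wins) =
    eetaWin-atnissWin-exclusive y-wins (allMoves y move)

  classify : (p : Path a b) → Acc _<_ (size p) →
             (Accepted p → EetaWin (idealOf p)) × (¬ Accepted p → AtnissWin (idealOf p))
  classify p (acc smaller) = accepted⇒eetaWin , rejected⇒atnissWin
    where
    accepted⇒eetaWin : Accepted p → EetaWin (idealOf p)
    accepted⇒eetaWin accepted = eeta λ y move →
      let p' , s , y≡p' = ungar→swap p move
      in subst AtnissWin (sym y≡p') (proj₂ (classify p' (smaller (swap-size-< s))) (swap-unaccepts s accepted))

    rejected⇒atnissWin : ¬ Accepted p → AtnissWin (idealOf p)
    rejected⇒atnissWin rejected =
      let p' , s , accepted′ = rejected⇒acceptingSwap p rejected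
      in atniss (idealOf p') (swap→ungar s) (proj₁ (classify p' (smaller (swap-size-< s))) accepted′)

  eetaWin⇔accepted : (p : Path a b) → EetaWin (idealOf p) ⇔ Accepted p
  eetaWin⇔accepted p = mk⇔ eetaWin⇒accepted (proj₁ (classify p (<-wellFounded (size p))))
    where
    eetaWin⇒accepted : EetaWin (idealOf p) → Accepted p
    eetaWin⇒accepted win with T? (accepting (run q0 p))
    ... | yes accepted = accepted
    ... | no rejected  =
      ⊥-elim (eetaWin-atnissWin-exclusive win (proj₂ (classify p (<-wellFounded (size p))) rejected))

  -- Counting

  south-injective : ∀ {p p' : Path a b} → south p ≡ south p' → p ≡ p'
  south-injective refl = refl

  west-injective : ∀ {p p' : Path a b} → west p ≡ west p' → p ≡ p'
  west-injective refl = refl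

  acceptedPaths : State → (a b : ℕ) → List (Path a b)
  acceptedPaths q zero    zero    = if accepting q then end ∷ [] else []
  acceptedPaths q (suc a) zero    = map south (acceptedPaths (readSouth q) a zero)
  acceptedPaths q zero    (suc b) = map west (acceptedPaths (readWest q) zero b)
  acceptedPaths q (suc a) (suc b) = map south (acceptedPaths (readSouth q) a (suc b))
                                 ++ map west (acceptedPaths (readWest q) (suc a) b)

  acceptedCount : State → ℕ → ℕ → ℕ
  acceptedCount q zero    zero    = if accepting q then 1 else 0
  acceptedCount q (suc a) zero    = acceptedCount (readSouth q) a zero
  acceptedCount q zero    (suc b) = acceptedCount (readWest q) zero b
  acceptedCount q (suc a) (suc b) = acceptedCount (readSouth q) a (suc b) + acceptedCount (readWest q) (suc a) b

  eetaCount : ℕ → ℕ → ℕ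
  eetaCount = acceptedCount q0

  length-acceptedPaths : ∀ q a b → length (acceptedPaths q a b) ≡ acceptedCount q a b
  length-acceptedPaths q zero zero with accepting q
  ... | true  = refl
  ... | false = refl
  length-acceptedPaths q (suc a) zero = trans (Listₚ.length-map south (acceptedPaths (readSouth q) a zero))
                                              (length-acceptedPaths (readSouth q) a zero)
  length-acceptedPaths q zero (suc b) = trans (Listₚ.length-map west (acceptedPaths (readWest q) zero b))
                                              (length-acceptedPaths (readWest q) zero b)
  length-acceptedPaths q (suc a) (suc b) = begin
    length (map south southward ++ map west westward)         ≡⟨ Listₚ.length-++ (map south southward) ⟩
    length (map south southward) + length (map west westward) ≡⟨ cong₂ _+_ (Listₚ.length-map south southward)
                                                                          (Listₚ.length-map west westward) ⟩
    length southward + length westward                        ≡⟨ cong₂ _+_ (length-acceptedPaths (readSouth q) a (suc b))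
                                                                          (length-acceptedPaths (readWest q) (suc a) b) ⟩
    acceptedCount q (suc a) (suc b)                           ∎
    where
    open ≡-Reasoning
    southward : List (Path a (suc b))
    southward = acceptedPaths (readSouth q) a (suc b)
    westward : List (Path (suc a) b)
    westward = acceptedPaths (readWest q) (suc a) b

  acceptedPaths-sound : ∀ q {a b} (p : Path a b) → p ∈ acceptedPaths q a b → AcceptedFrom q p
  acceptedPaths-sound q end p∈ with accepting q
  acceptedPaths-sound q end (here refl) | true = _
  acceptedPaths-sound q (south {b = zero} p) p∈ with ∈-map⁻ south p∈
  ... | _ , p∈′ , refl = acceptedPaths-sound (readSouth q) p p∈′
  acceptedPaths-sound q (south {a} {suc b} p) p∈ with ∈-++⁻ (map south (acceptedPaths (readSouth q) a (suc b))) p∈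
  ... | inj₁ p∈ˢ with ∈-map⁻ south p∈ˢ
  ...   | _ , p∈′ , refl = acceptedPaths-sound (readSouth q) p p∈′
  acceptedPaths-sound q (south p) p∈ | inj₂ p∈ʷ with ∈-map⁻ west p∈ʷ
  ...   | _ , _ , ()
  acceptedPaths-sound q (west {zero} p) p∈ with ∈-map⁻ west p∈
  ... | _ , p∈′ , refl = acceptedPaths-sound (readWest q) p p∈′
  acceptedPaths-sound q (west {suc a} {b} p) p∈ with ∈-++⁻ (map south (acceptedPaths (readSouth q) a (suc b))) p∈
  ... | inj₂ p∈ʷ with ∈-map⁻ west p∈ʷ
  ...   | _ , p∈′ , refl = acceptedPaths-sound (readWest q) p p∈′
  acceptedPaths-sound q (west p) p∈ | inj₁ p∈ˢ with ∈-map⁻ south p∈ˢ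
  ...   | _ , _ , ()

  acceptedPaths-complete : ∀ q {a b} (p : Path a b) → AcceptedFrom q p → p ∈ acceptedPaths q a b
  acceptedPaths-complete q end accepted with accepting q
  ... | true = here refl
  acceptedPaths-complete q (south {b = zero} p)  accepted =
    ∈-map⁺ south (acceptedPaths-complete (readSouth q) p accepted)
  acceptedPaths-complete q (south {b = suc b} p) accepted =
    ∈-++⁺ˡ (∈-map⁺ south (acceptedPaths-complete (readSouth q) p accepted))
  acceptedPaths-complete q (west {zero} p)       accepted =
    ∈-map⁺ west (acceptedPaths-complete (readWest q) p accepted)
  acceptedPaths-complete q (west {suc a} p)      accepted =
    ∈-++⁺ʳ (map south (acceptedPaths (readSouth q) a _)) (∈-map⁺ west (acceptedPaths-complete (readWest q) p accepted))

  acceptedPaths-unique : ∀ q a b → Unique (acceptedPaths q a b)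
  acceptedPaths-unique q zero zero with accepting q
  ... | true  = [] ∷ []
  ... | false = []
  acceptedPaths-unique q (suc a) zero = Uniqueₚ.map⁺ south-injective (acceptedPaths-unique (readSouth q) a zero)
  acceptedPaths-unique q zero (suc b) = Uniqueₚ.map⁺ west-injective (acceptedPaths-unique (readWest q) zero b)
  acceptedPaths-unique q (suc a) (suc b) =
    Uniqueₚ.++⁺ (Uniqueₚ.map⁺ south-injective (acceptedPaths-unique (readSouth q) a (suc b)))
                (Uniqueₚ.map⁺ west-injective (acceptedPaths-unique (readWest q) (suc a) b))
                southward-westward-disjoint
    where
    southward-westward-disjoint : ∀ {p} → ¬ (p ∈ map south (acceptedPaths (readSouth q) a (suc b))
                                            × p ∈ map west (acceptedPaths (readWest q) (suc a) b))
    southward-westward-disjoint (p∈ˢ , p∈ʷ) with ∈-map⁻ south p∈ˢ | ∈-map⁻ west p∈ʷ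
    ... | _ , _ , refl | _ , _ , ()

  cardE : ∀ a b → CardE a b (eetaCount a b)
  cardE a b = map idealOf paths , unique , sound , complete ,
              trans (Listₚ.length-map idealOf paths) (length-acceptedPaths q0 a b)
    where
    paths : List (Path a b)
    paths = acceptedPaths q0 a b

    unique : Unique (map idealOf paths)
    unique = Uniqueₚ.map⁺ (idealOf-injective _ _) (acceptedPaths-unique q0 a b)

    sound : ∀ x → x ∈ map idealOf paths → IsIdeal x × EetaWin x
    sound x x∈ with ∈-map⁻ idealOf x∈
    ... | p , p∈ , refl = idealOf-isIdeal p , Equivalence.from (eetaWin⇔accepted p) (acceptedPaths-sound q0 p p∈)

    complete : ∀ x → IsIdeal x → EetaWin x → x ∈ map idealOf paths
    complete x ideal win with idealOf-surjective x ideal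
    ... | p , refl = ∈-map⁺ idealOf (acceptedPaths-complete q0 p (Equivalence.to (eetaWin⇔accepted p) win))

  acceptedCount-dead : ∀ a b → acceptedCount q3 a b ≡ 0
  acceptedCount-dead zero    zero    = refl
  acceptedCount-dead (suc a) zero    = acceptedCount-dead a zero
  acceptedCount-dead zero    (suc b) = acceptedCount-dead zero b
  acceptedCount-dead (suc a) (suc b) = cong₂ _+_ (acceptedCount-dead a (suc b)) (acceptedCount-dead (suc a) b)

  acceptedCount-split : ∀ a b → acceptedCount q0 a b ≡ acceptedCount q2 a b + acceptedCount q4 a b
  acceptedCount-split zero    zero    = refl
  acceptedCount-split (suc a) zero    rewrite acceptedCount-dead a zero = refl
  acceptedCount-split zero    (suc b) =
    trans (acceptedCount-split zero b) (ℕₚ.+-comm (acceptedCount q2 0 b) (acceptedCount q4 0 b))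
  acceptedCount-split (suc a) (suc b)
    rewrite acceptedCount-split (suc a) b | acceptedCount-dead a (suc b) =
      +-rearrange (acceptedCount q1 a (suc b)) (acceptedCount q2 (suc a) b) (acceptedCount q4 (suc a) b)
    where
    +-rearrange : ∀ x y z → x + (y + z) ≡ z + (x + y)
    +-rearrange = solve-∀

  behind : ℕ → ℕ → (ℕ → ℕ → ℕ) → ℕ → ℕ → ℕ
  behind p q c a b = if p ℕ.≤ᵇ a then (if q ℕ.≤ᵇ b then c (a ∸ p) (b ∸ q) else 0) else 0

  nearOrigin : ℕ → ℕ → ℕ
  nearOrigin a b = if a ℕ.≤ᵇ 1 then (if b ℕ.≤ᵇ 1 then 1 else 0) else 0

  eetaCount-recurrence : ∀ a b → eetaCount a b ≡ nearOrigin a b +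
    (behind 2 0 eetaCount a b + behind 2 1 eetaCount a b + behind 0 2 eetaCount a b + behind 1 2 eetaCount a b)
  eetaCount-recurrence zero             zero             = refl
  eetaCount-recurrence zero             (suc zero)       = refl
  eetaCount-recurrence (suc zero)       zero             = refl
  eetaCount-recurrence (suc zero)       (suc zero)       = refl
  eetaCount-recurrence zero             (suc (suc b))    = sym (ℕₚ.+-identityʳ _)
  eetaCount-recurrence (suc zero)       (suc (suc b))
    rewrite acceptedCount-split zero b = rearrange (eetaCount 1 b) (acceptedCount q2 0 b) (acceptedCount q4 0 b)
    where
    rearrange : ∀ x y z → z + (y + x) ≡ x + (y + z)
    rearrange = solve-∀
  eetaCount-recurrence (suc (suc a))    zero             =
    sym (trans (ℕₚ.+-identityʳ _) (trans (ℕₚ.+-identityʳ _) (ℕₚ.+-identityʳ _)))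
  eetaCount-recurrence (suc (suc a))    (suc zero)
    rewrite acceptedCount-dead a zero = rearrange (eetaCount a 1) (eetaCount a 0)
    where
    rearrange : ∀ x y → x + 0 + y ≡ x + y + 0 + 0
    rearrange = solve-∀
  eetaCount-recurrence (suc (suc a))    (suc (suc b))
    rewrite acceptedCount-dead a (suc b) | acceptedCount-split (suc a) b =
      rearrange (eetaCount a (suc (suc b))) (acceptedCount q4 (suc a) b) (eetaCount a (suc b))
                (acceptedCount q2 (suc a) b) (eetaCount (suc (suc a)) b)
    where
    rearrange : ∀ v w x y z → v + w + (x + y + z) ≡ v + x + z + (y + w)
    rearrange = solve-∀

module Coefficients where

  open import Data.Nat as ℕ using (ℕ; zero; suc; _∸_; _≤_; _≤ᵇ_; _≡ᵇ_; z≤n)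
  import Data.Nat.Properties as ℕₚ
  open import Data.Integer using (ℤ; +_; _+_; _-_; _*_)
  import Data.Integer.Properties as ℤₚ
  open import Data.Integer.Tactic.RingSolver using (solve-∀)
  open import Data.Bool using (true; false; T; if_then_else_)
  import Data.Bool.Properties as Boolₚ
  open import Function using (_∘_; Equivalence)
  open import Relation.Nullary using (yes; no; contradiction)
  open import Relation.Binary.PropositionalEquality
    using (_≡_; _≢_; refl; sym; trans; cong; cong₂; subst; module ≡-Reasoning)
  open EetaWins using (eetaCount; behind; nearOrigin; eetaCount-recurrence)

  sumTo-cong : ∀ n {g h : ℕ → ℤ} → (∀ k → k ≤ n → g k ≡ h k) → sumTo n g ≡ sumTo n h
  sumTo-cong zero    g≡h = g≡h zero z≤n
  sumTo-cong (suc n) g≡h = cong₂ _+_ (sumTo-cong n λ k k≤n → g≡h k (ℕₚ.m≤n⇒m≤1+n k≤n)) (g≡h (suc n) ℕₚ.≤-refl)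

  sumTo-+ : ∀ n (g h : ℕ → ℤ) → sumTo n (λ k → g k + h k) ≡ sumTo n g + sumTo n h
  sumTo-+ zero    g h = refl
  sumTo-+ (suc n) g h = trans (cong (_+ (g (suc n) + h (suc n))) (sumTo-+ n g h))
                              (interchange (sumTo n g) (sumTo n h) (g (suc n)) (h (suc n)))
    where
    interchange : ∀ w x y z → (w + x) + (y + z) ≡ (w + y) + (x + z)
    interchange = solve-∀

  sumTo-- : ∀ n (g h : ℕ → ℤ) → sumTo n (λ k → g k - h k) ≡ sumTo n g - sumTo n h
  sumTo-- zero    g h = refl
  sumTo-- (suc n) g h = trans (cong (_+ (g (suc n) - h (suc n))) (sumTo-- n g h))
                              (interchange (sumTo n g) (sumTo n h) (g (suc n)) (h (suc n)))
    where
    interchange : ∀ w x y z → (w - x) + (y - z) ≡ (w + y) - (x + z)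
    interchange = solve-∀

  sumTo-zero : ∀ n {g : ℕ → ℤ} → (∀ k → k ≤ n → g k ≡ + 0) → sumTo n g ≡ + 0
  sumTo-zero zero    g≡0 = g≡0 zero z≤n
  sumTo-zero (suc n) g≡0 =
    cong₂ _+_ (sumTo-zero n λ k k≤n → g≡0 k (ℕₚ.m≤n⇒m≤1+n k≤n)) (g≡0 (suc n) ℕₚ.≤-refl)

  sumTo-single : ∀ n {m} {g : ℕ → ℤ} → m ≤ n → (∀ k → k ≤ n → k ≢ m → g k ≡ + 0) → sumTo n g ≡ g m
  sumTo-single zero    z≤n _ = refl
  sumTo-single (suc n) {m} {g} m≤1+n g≡0 with m ℕ.≟ suc n
  ... | yes refl =
    trans (cong (_+ g (suc n)) (sumTo-zero n λ k k≤n → g≡0 k (ℕₚ.m≤n⇒m≤1+n k≤n) (λ { refl → ℕₚ.1+n≰n k≤n })))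
          (ℤₚ.+-identityˡ (g (suc n)))
  ... | no m≢1+n =
    trans (cong₂ _+_ (sumTo-single n (ℕₚ.≤-pred (ℕₚ.≤∧≢⇒< m≤1+n m≢1+n)) λ k k≤n → g≡0 k (ℕₚ.m≤n⇒m≤1+n k≤n))
                     (g≡0 (suc n) ℕₚ.≤-refl (m≢1+n ∘ sym)))
          (ℤₚ.+-identityʳ (g m))

  private
    T-from : ∀ {x} → x ≡ true → T x
    T-from = Equivalence.from Boolₚ.T-≡

  sumTo-picked : ∀ n t (v : ℕ → ℤ) →
                 sumTo n (λ k → if n ∸ k ≡ᵇ t then v k else + 0) ≡ (if t ≤ᵇ n then v (n ∸ t) else + 0)
  sumTo-picked n t v with t ≤ᵇ n in t≤ᵇn
  ... | true = trans (sumTo-single n (ℕₚ.m∸n≤m n t) unpicked) picked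
    where
    t≤n : t ≤ n
    t≤n = ℕₚ.≤ᵇ⇒≤ t n (T-from t≤ᵇn)

    unpicked : ∀ k → k ≤ n → k ≢ n ∸ t → (if n ∸ k ≡ᵇ t then v k else + 0) ≡ + 0
    unpicked k k≤n k≢n∸t with n ∸ k ≡ᵇ t in n∸k≡ᵇt
    ... | true  = contradiction
      (trans (sym (ℕₚ.m∸[m∸n]≡n k≤n)) (cong (n ∸_) (ℕₚ.≡ᵇ⇒≡ (n ∸ k) t (T-from n∸k≡ᵇt)))) k≢n∸t
    ... | false = refl

    picked : (if n ∸ (n ∸ t) ≡ᵇ t then v (n ∸ t) else + 0) ≡ v (n ∸ t)
    picked rewrite ℕₚ.m∸[m∸n]≡n t≤n | Equivalence.to Boolₚ.T-≡ (ℕₚ.≡⇒≡ᵇ t t refl) = refl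
  ... | false = sumTo-zero n unpicked
    where
    unpicked : ∀ k → k ≤ n → (if n ∸ k ≡ᵇ t then v k else + 0) ≡ + 0
    unpicked k k≤n with n ∸ k ≡ᵇ t in n∸k≡ᵇt
    ... | false = refl
    ... | true  = contradiction (ℕₚ.≤⇒≤ᵇ (subst (_≤ n) (ℕₚ.≡ᵇ⇒≡ (n ∸ k) t (T-from n∸k≡ᵇt)) (ℕₚ.m∸n≤m n k)))
                                (subst T t≤ᵇn)

  monomial : ℕ → ℕ → PS
  monomial p q i j = if i ≡ᵇ p then (if j ≡ᵇ q then + 1 else + 0) else + 0

  shift : ℕ → ℕ → PS → PS
  shift p q f i j = if p ≤ᵇ i then (if q ≤ᵇ j then f (i ∸ p) (j ∸ q) else + 0) else + 0

  ⊛-monomial : ∀ f p q i j → (f ⊛ monomial p q) i j ≡ shift p q f i j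
  ⊛-monomial f p q i j =
    trans (sumTo-cong i λ k _ → row k) (sumTo-picked i p λ k → if q ≤ᵇ j then f k (j ∸ q) else + 0)
    where
    *-indicator : ∀ x c → x * (if c then + 1 else + 0) ≡ (if c then x else + 0)
    *-indicator x true  = ℤₚ.*-identityʳ x
    *-indicator x false = ℤₚ.*-zeroʳ x

    row : ∀ k → sumTo j (λ l → f k l * monomial p q (i ∸ k) (j ∸ l))
              ≡ (if i ∸ k ≡ᵇ p then (if q ≤ᵇ j then f k (j ∸ q) else + 0) else + 0)
    row k with i ∸ k ≡ᵇ p
    ... | false = sumTo-zero j λ l _ → ℤₚ.*-zeroʳ (f k l)
    ... | true  = trans (sumTo-cong j λ l _ → *-indicator (f k l) (j ∸ l ≡ᵇ q)) (sumTo-picked j q (f k))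

  ⊛-congʳ : ∀ f {g h} → (∀ i j → g i j ≡ h i j) → ∀ i j → (f ⊛ g) i j ≡ (f ⊛ h) i j
  ⊛-congʳ f g≡h i j = sumTo-cong i λ k _ → sumTo-cong j λ l _ → cong (f k l *_) (g≡h (i ∸ k) (j ∸ l))

  ⊛-⊕ʳ : ∀ f g h i j → (f ⊛ (g ⊕ h)) i j ≡ (f ⊛ g) i j + (f ⊛ h) i j
  ⊛-⊕ʳ f g h i j = trans (sumTo-cong i λ k _ →
      trans (sumTo-cong j λ l _ → ℤₚ.*-distribˡ-+ (f k l) (g (i ∸ k) (j ∸ l)) (h (i ∸ k) (j ∸ l))) (sumTo-+ j _ _))
    (sumTo-+ i _ _)

  ⊛-⊖ʳ : ∀ f g h i j → (f ⊛ (g ⊖ h)) i j ≡ (f ⊛ g) i j - (f ⊛ h) i j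
  ⊛-⊖ʳ f g h i j = trans (sumTo-cong i λ k _ →
      trans (sumTo-cong j λ l _ → *-distribˡ-- (f k l) (g (i ∸ k) (j ∸ l)) (h (i ∸ k) (j ∸ l))) (sumTo-- j _ _))
    (sumTo-- i _ _)
    where
    *-distribˡ-- : ∀ x y z → x * (y - z) ≡ x * y - x * z
    *-distribˡ-- = solve-∀

  𝟙-monomial : ∀ i j → 𝟙 i j ≡ monomial 0 0 i j
  𝟙-monomial zero    zero    = refl
  𝟙-monomial zero    (suc j) = refl
  𝟙-monomial (suc i) j       = refl

  X-monomial : ∀ i j → X i j ≡ monomial 1 0 i j
  X-monomial zero          j       = refl
  X-monomial (suc zero)    zero    = refl
  X-monomial (suc zero)    (suc j) = refl
  X-monomial (suc (suc i)) j       = refl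

  Y-monomial : ∀ i j → Y i j ≡ monomial 0 1 i j
  Y-monomial zero    zero          = refl
  Y-monomial zero    (suc zero)    = refl
  Y-monomial zero    (suc (suc j)) = refl
  Y-monomial (suc i) j             = refl

  shift-cong : ∀ p q {f g : PS} → (∀ i j → f i j ≡ g i j) → ∀ i j → shift p q f i j ≡ shift p q g i j
  shift-cong p q f≡g i j = cong (λ v → if p ≤ᵇ i then (if q ≤ᵇ j then v else + 0) else + 0) (f≡g (i ∸ p) (j ∸ q))

  ⊛Y : ∀ f i j → (f ⊛ Y) i j ≡ shift 0 1 f i j
  ⊛Y f i j = trans (⊛-congʳ f Y-monomial i j) (⊛-monomial f 0 1 i j)

  ⊛X : ∀ f i j → (f ⊛ X) i j ≡ shift 1 0 f i j
  ⊛X f i j = trans (⊛-congʳ f X-monomial i j) (⊛-monomial f 1 0 i j)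

  denominator : PS
  denominator = monomial 0 0 ⊖ monomial 0 2 ⊖ monomial 1 2 ⊖ monomial 2 0 ⊖ monomial 2 1

  denominator-expand : ∀ i j → (𝟙 ⊖ (𝟙 ⊕ X) ⊛ Y ⊛ Y ⊖ (𝟙 ⊕ Y) ⊛ X ⊛ X) i j ≡ denominator i j
  denominator-expand i j = trans (cong₂ (λ u v → 𝟙 i j - u - v) Y² X²) (expanded i j)
    where
    Y² : ((𝟙 ⊕ X) ⊛ Y ⊛ Y) i j ≡ shift 0 1 (shift 0 1 (𝟙 ⊕ X)) i j
    Y² = trans (⊛Y ((𝟙 ⊕ X) ⊛ Y) i j) (shift-cong 0 1 (⊛Y (𝟙 ⊕ X)) i j)

    X² : ((𝟙 ⊕ Y) ⊛ X ⊛ X) i j ≡ shift 1 0 (shift 1 0 (𝟙 ⊕ Y)) i j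
    X² = trans (⊛X ((𝟙 ⊕ Y) ⊛ X) i j) (shift-cong 1 0 (⊛X (𝟙 ⊕ Y)) i j)

    expanded : ∀ i j → 𝟙 i j - shift 0 1 (shift 0 1 (𝟙 ⊕ X)) i j - shift 1 0 (shift 1 0 (𝟙 ⊕ Y)) i j
                       ≡ denominator i j
    expanded 0                   0                   = refl
    expanded 0                   1                   = refl
    expanded 0                   2                   = refl
    expanded 0                   (suc (suc (suc j))) = refl
    expanded 1                   0                   = refl
    expanded 1                   1                   = refl
    expanded 1                   2                   = refl
    expanded 1                   (suc (suc (suc j))) = refl
    expanded 2                   0                   = refl
    expanded 2                   1                   = refl
    expanded 2                   2                   = refl
    expanded 2                   (suc (suc (suc j))) = refl
    expanded (suc (suc (suc i))) 0                   = refl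
    expanded (suc (suc (suc i))) 1                   = refl
    expanded (suc (suc (suc i))) 2                   = refl
    expanded (suc (suc (suc i))) (suc (suc (suc j))) = refl

  ⊛-denominator : ∀ f i j →
    (f ⊛ denominator) i j ≡ f i j - shift 0 2 f i j - shift 1 2 f i j - shift 2 0 f i j - shift 2 1 f i j
  ⊛-denominator f i j =
    trans (⊛-⊖ʳ f (monomial 0 0 ⊖ monomial 0 2 ⊖ monomial 1 2 ⊖ monomial 2 0) (monomial 2 1) i j) (cong₂ _-_
      (trans (⊛-⊖ʳ f (monomial 0 0 ⊖ monomial 0 2 ⊖ monomial 1 2) (monomial 2 0) i j) (cong₂ _-_
        (trans (⊛-⊖ʳ f (monomial 0 0 ⊖ monomial 0 2) (monomial 1 2) i j) (cong₂ _-_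
          (trans (⊛-⊖ʳ f (monomial 0 0) (monomial 0 2) i j) (cong₂ _-_ (⊛-monomial f 0 0 i j) (⊛-monomial f 0 2 i j)))
          (⊛-monomial f 1 2 i j)))
        (⊛-monomial f 2 0 i j)))
      (⊛-monomial f 2 1 i j))

  numerator-coefficient : ∀ i j → ((𝟙 ⊕ X) ⊛ (𝟙 ⊕ Y)) i j ≡ + nearOrigin j i
  numerator-coefficient i j =
    trans (⊛-congʳ (𝟙 ⊕ X) (λ i j → cong₂ _+_ (𝟙-monomial i j) (Y-monomial i j)) i j)
    (trans (⊛-⊕ʳ (𝟙 ⊕ X) (monomial 0 0) (monomial 0 1) i j)
    (trans (cong₂ _+_ (⊛-monomial (𝟙 ⊕ X) 0 0 i j) (⊛-monomial (𝟙 ⊕ X) 0 1 i j))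
           (expanded i j)))
    where
    expanded : ∀ i j → shift 0 0 (𝟙 ⊕ X) i j + shift 0 1 (𝟙 ⊕ X) i j ≡ + nearOrigin j i
    expanded 0             0             = refl
    expanded 0             1             = refl
    expanded 0             (suc (suc j)) = refl
    expanded 1             0             = refl
    expanded 1             1             = refl
    expanded 1             (suc (suc j)) = refl
    expanded (suc (suc i)) 0             = refl
    expanded (suc (suc i)) 1             = refl
    expanded (suc (suc i)) (suc (suc j)) = refl

  shift-transpose : ∀ p q (c : ℕ → ℕ → ℕ) i j → shift p q (λ i j → + c j i) i j ≡ + behind q p c j i
  shift-transpose p q c i j with p ≤ᵇ i | q ≤ᵇ j
  ... | true  | true  = refl
  ... | true  | false = refl
  ... | false | true  = refl
  ... | false | false = refl

  cancel : ∀ n x y z u v → x ≡ n ℕ.+ (y ℕ.+ z ℕ.+ u ℕ.+ v) → + x - + y - + z - + u - + v ≡ + n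
  cancel n x y z u v refl =
    trans (cong (λ t → t - + y - + z - + u - + v) embed) (rearrange (+ n) (+ y) (+ z) (+ u) (+ v))
    where
    embed : + (n ℕ.+ (y ℕ.+ z ℕ.+ u ℕ.+ v)) ≡ + n + (+ y + + z + + u + + v)
    embed = trans (ℤₚ.pos-+ n _) (cong (λ t → + n + t) (trans (ℤₚ.pos-+ (y ℕ.+ z ℕ.+ u) v)
              (cong (_+ + v) (trans (ℤₚ.pos-+ (y ℕ.+ z) u) (cong (_+ + u) (ℤₚ.pos-+ y z))))))
    rearrange : ∀ n y z u v → n + (y + z + u + v) - y - z - u - v ≡ n
    rearrange = solve-∀

  coefficient-identity : ∀ i j →
    ((λ i' j' → + eetaCount j' i') ⊛ (𝟙 ⊖ (𝟙 ⊕ X) ⊛ Y ⊛ Y ⊖ (𝟙 ⊕ Y) ⊛ X ⊛ X)) i j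
      ≡ ((𝟙 ⊕ X) ⊛ (𝟙 ⊕ Y)) i j
  coefficient-identity i j = begin
    (E ⊛ (𝟙 ⊖ (𝟙 ⊕ X) ⊛ Y ⊛ Y ⊖ (𝟙 ⊕ Y) ⊛ X ⊛ X)) i j
      ≡⟨ ⊛-congʳ E denominator-expand i j ⟩
    (E ⊛ denominator) i j
      ≡⟨ ⊛-denominator E i j ⟩
    E i j - shift 0 2 E i j - shift 1 2 E i j - shift 2 0 E i j - shift 2 1 E i j
      ≡⟨ cong₂ _-_ (cong₂ _-_ (cong₂ _-_ (cong (E i j -_) (transpose 0 2)) (transpose 1 2)) (transpose 2 0))
                   (transpose 2 1) ⟩
    + eetaCount j i - + B 2 0 - + B 2 1 - + B 0 2 - + B 1 2
      ≡⟨ cancel (nearOrigin j i) (eetaCount j i) (B 2 0) (B 2 1) (B 0 2) (B 1 2) (eetaCount-recurrence j i) ⟩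
    + nearOrigin j i
      ≡⟨ numerator-coefficient i j ⟨
    ((𝟙 ⊕ X) ⊛ (𝟙 ⊕ Y)) i j ∎
    where
    open ≡-Reasoning
    E : PS
    E i' j' = + eetaCount j' i'
    B : ℕ → ℕ → ℕ
    B p q = behind p q eetaCount j i
    transpose : ∀ p q → shift p q E i j ≡ + B q p
    transpose p q = shift-transpose p q eetaCount i j

open EetaWins using (eetaCount; cardE)
open Coefficients using (coefficient-identity)

theorem1p8 : Σ (ℕ → ℕ → ℕ) λ e →
    (∀ a b → CardE a b (e a b))
    × (∀ i j →
        ((λ i' j' → + e j' i') ⊛ (𝟙 ⊖ (𝟙 ⊕ X) ⊛ Y ⊛ Y ⊖ (𝟙 ⊕ Y) ⊛ X ⊛ X)) i j
          ≡ ((𝟙 ⊕ X) ⊛ (𝟙 ⊕ Y)) i j)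
theorem1p8 = eetaCount , cardE , coefficient-identity
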